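{- For all compositions $\alpha,\beta$ of $n$ and $N\ge n$, the coefficient of $G_\beta(x_1,\ldots,x_N;t)$ in the expansion of $M_\alpha(x_1,\ldots,x_N)$ in the basis $\{G_\gamma\}_\gamma$ equals $(-1)^{\ell(\beta)-\ell(\alpha)}\prod_{j:\ \xi_{\alpha,\beta}(j)=j}(1-t^j)$ if $\beta\succeq\alpha$, and $0$ otherwise.
   Context: For a composition $\alpha=(\alpha_1,\ldots,\alpha_k)$ of $n$, $\ell(\alpha)=k$ and $\mathrm{sub}(\alpha)=\{\alpha_1,\alpha_1+\alpha_2,\ldots,\alpha_1+\cdots+\alpha_{k-1}\}$. $\beta\succeq\alpha$ iff $\mathrm{sub}(\alpha)\subseteq\mathrm{sub}(\beta)$. If $\beta\succeq\alpha$ with $\ell(\beta)=m$, write $\alpha_j=\beta_{i_{j-1}+1}+\dots+\beta_{i_j}$ with $0=i_0<\dots<i_k=m$, and $s(\alpha,\beta)=\sum_{j=1}^k j(i_j-i_{j-1}-1)$. For $1\le j\le\ell(\beta)-1$, $\xi_{\alpha,\beta}(j)=j$ if $\beta_j,\beta_{j+1}$ are formed from the same part of $\alpha$ (i.e. $\beta_1+\dots+\beta_j\notin\mathrm{sub}(\alpha)$) and $0$ otherwise. $M_\alpha(x_1,\ldots,x_N)=\sum_{1\le i_1<\dots<i_k\le N}x_{i_1}^{\alpha_1}\cdots x_{i_k}^{\alpha_k}$ is the monomial quasisymmetric polynomial. $F_\alpha(x_1,\ldots,x_N)=\sum x_{w_1}\cdots x_{w_n}$ over $1\le w_1\le\dots\le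 w_n\le N$ with $w_j<w_{j+1}$ for $j\in\mathrm{sub}(\alpha)$. Hivert's quasisymmetric Hall–Littlewood polynomials satisfy (and may be taken to be defined by) $G_\alpha(x_1,\ldots,x_N;t)=\sum_{\beta\succeq\alpha}(-1)^{\ell(\beta)-\ell(\alpha)}t^{s(\alpha,\beta)}F_\beta$; for $N\ge n$ they form a basis of the degree-$n$ quasisymmetric polynomials over $\mathbb{Q}(t)$. -}

module Defs where

open import Level using (Level)
open import Algebra.Bundles using (CommutativeRing)
open import Data.Bool using (if_then_else_)
open import Data.Nat as ℕ using (ℕ; zero; suc; _≤_)
open import Data.Nat.ListAction using (sum)
open import Data.Fin as Fin using (Fin)
open import Data.Fin.Properties as FinP using ()
open import Data.List using (List; []; _∷_; [_]; map; concatMap; allFin; length; take; filter; zip; upTo; foldr)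
open import Data.List.Relation.Unary.All using (All; all?)
open import Data.List.Relation.Unary.Linked using (Linked; linked?)
open import Data.List.Membership.Propositional using (_∈_)
open import Data.List.Membership.DecPropositional ℕ._≟_ using (_∈?_)
open import Data.Vec using (Vec; tabulate)
open import Data.Vec.Properties using (≡-dec)
open import Data.Product using (_×_; _,_; proj₁; proj₂)
open import Relation.Nullary using (Dec; ¬_)
open import Relation.Nullary.Decidable using (⌊_⌋; _×-dec_; _→-dec_; ¬?)
open import Relation.Binary.PropositionalEquality using (_≡_)

IsComposition : ℕ → List ℕ → Set
IsComposition n α = All (λ a → 1 ≤ a) α × sum α ≡ n

incHead : List ℕ → List ℕ
incHead []      = []
incHead (a ∷ α) = suc a ∷ α

-- enumeration of all compositions of n (each exactly once):
-- compositions of n+1 arise from those of n by prepending a part 1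
-- or increasing the first part.
compositions : ℕ → List (List ℕ)
compositions zero          = [ [] ]
compositions (suc zero)    = [ 1 ∷ [] ]
compositions (suc (suc n)) =
  concatMap (λ α → (1 ∷ α) ∷ incHead α ∷ []) (compositions (suc n))

ℓ : List ℕ → ℕ
ℓ = length

sub : List ℕ → List ℕ
sub []          = []
sub (a ∷ [])    = []
sub (a ∷ b ∷ α) = a ∷ map (a ℕ.+_) (sub (b ∷ α))

_⪰_ : List ℕ → List ℕ → Set
β ⪰ α = All (λ x → x ∈ sub β) (sub α)

_⪰?_ : (β α : List ℕ) → Dec (β ⪰ α)
β ⪰? α = all? (λ x → x ∈? sub β) (sub α)

-- For β ⪰ α: the numbers i_j − i_{j−1} of parts of β making up α_j.
-- takeParts a β: number of leading parts of β that sum to a, and the rest.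
takeParts : ℕ → List ℕ → ℕ × List ℕ
takeParts zero    bs       = 0 , bs
takeParts (suc a) []       = 0 , []
takeParts (suc a) (b ∷ bs) =
  let r = takeParts (suc a ℕ.∸ b) bs in suc (proj₁ r) , proj₂ r

blockSizes : List ℕ → List ℕ → List ℕ
blockSizes []      bs = []
blockSizes (a ∷ α) bs =
  let r = takeParts a bs in proj₁ r ∷ blockSizes α (proj₂ r)

-- s(α,β) = Σ_j j (i_j − i_{j−1} − 1)
sWeighted : ℕ → List ℕ → ℕ
sWeighted j []       = 0
sWeighted j (c ∷ cs) = j ℕ.* (c ℕ.∸ 1) ℕ.+ sWeighted (suc j) cs

s : List ℕ → List ℕ → ℕ
s α β = sWeighted 1 (blockSizes α β)

psum : List ℕ → ℕ → ℕ
psum β j = sum (take j β)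

allWords : ℕ → (N : ℕ) → List (List (Fin N))
allWords zero    N = [ [] ]
allWords (suc k) N = concatMap (λ w → map (_∷ w) (allFin N)) (allWords k N)

-- (j, w_j, w_{j+1}) for 1 ≤ j < length w  (positions 1-indexed)
adjacent : {A : Set} → ℕ → List A → List (ℕ × A × A)
adjacent j []           = []
adjacent j (a ∷ [])     = []
adjacent j (a ∷ b ∷ w)  = (j , a , b) ∷ adjacent (suc j) (b ∷ w)

-- exponent vector (content) of the monomial x_{w₁}⋯x_{w_n}
content : {N : ℕ} → List (Fin N) → Vec ℕ N
content w = tabulate (λ i → length (filter (λ j → j Fin.≟ i) w))

-- exponent vector of x_{i₁}^{α₁}⋯x_{i_k}^{α_k}
expVec : {N : ℕ} → List ℕ → List (Fin N) → Vec ℕ N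
expVec α is = tabulate (λ i → sum (map proj₁ (filter (λ p → proj₂ p Fin.≟ i) (zip α is))))

-- Polynomials in x₁,…,x_N with coefficients in a commutative ring R,
-- represented by their coefficient function on exponent vectors.

module Poly {c ℓ′ : Level} (R : CommutativeRing c ℓ′) where
  open CommutativeRing R

  Polynomial : ℕ → Set c
  Polynomial N = Vec ℕ N → Carrier

  ι : {P : Set} → Dec P → Carrier
  ι d = if ⌊ d ⌋ then 1# else 0#

  ΣR : {A : Set} → List A → (A → Carrier) → Carrier
  ΣR xs f = foldr (λ x acc → f x + acc) 0# xs

  _^_ : Carrier → ℕ → Carrier
  x ^ zero  = 1#
  x ^ suc k = x * (x ^ k)

  ΠR : {A : Set} → List A → (A → Carrier) → Carrier
  ΠR xs f = foldr (λ x acc → f x * acc) 1# xs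

  M : {N : ℕ} → List ℕ → Polynomial N
  M {N} α e = ΣR (allWords (ℓ α) N) λ is →
    ι (linked? Fin._<?_ is) * ι (≡-dec ℕ._≟_ (expVec α is) e)

  F : {N : ℕ} → ℕ → List ℕ → Polynomial N
  F {N} n β e = ΣR (allWords n N) λ w →
    ι (all? (λ p → (proj₁ (proj₂ p) Fin.≤? proj₂ (proj₂ p))
                   ×-dec ((proj₁ p ∈? sub β) →-dec (proj₁ (proj₂ p) Fin.<? proj₂ (proj₂ p))))
            (adjacent 1 w))
    * ι (≡-dec ℕ._≟_ (content w) e)

  G : {N : ℕ} → Carrier → ℕ → List ℕ → Polynomial N
  G t n α e = ΣR (compositions n) λ β →
    ι (β ⪰? α) * (((- 1#) ^ (ℓ β ℕ.∸ ℓ α)) * ((t ^ s α β) * F n β e))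

  -- the claimed coefficient of G_β in M_α:
  -- (-1)^{ℓ(β)-ℓ(α)} ∏_{j : ξ_{α,β}(j) = j} (1 - t^j) if β ⪰ α, else 0.
  -- ξ_{α,β}(j) = j  iff  β₁+⋯+β_j ∉ sub(α)   (1 ≤ j ≤ ℓ(β)-1)
  coeffMG : Carrier → List ℕ → List ℕ → Carrier
  coeffMG t α β =
    ι (β ⪰? α) * (((- 1#) ^ (ℓ β ℕ.∸ ℓ α))
      * ΠR (map suc (upTo (ℓ β ℕ.∸ 1))) λ j →
          ι (¬? (psum β j ∈? sub α)) * (1# - t ^ j) + ι (psum β j ∈? sub α))

module Submission where

-- Both sides are compared coefficientwise, at an exponent vector e. There M_α is 1
-- exactly when the nonzero entries of e form α, and F_β is 1 exactly when every partial
-- sum of β is a strict ascent of the weakly increasing word with content e (no other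
-- word contributes). Encoding a composition of m + 1 by its cut sequence in {0,1}^m,
-- refinement becomes the pointwise order of cut sequences, and the right-hand side at e
-- becomes a double sum Σ_b c(a,b) Σ_d ±t^s(b,d) [d ⊑ g], where g is the ascent sequence
-- of that word. That this double sum equals [a = g] is proved by induction on m, splitting
-- off the first letters of the cut sequences: each case either reduces to the same identity
-- for the tails or cancels, as -(1 - t^j) + (1 - t^j) = 0.

open import Defs
open import Level using (Level)
open import Algebra.Bundles using (CommutativeRing)
open import Data.Bool.Base using (Bool; true; false; _∧_; _∨_; not; if_then_else_)
open import Data.Nat.Base as ℕ using (ℕ; zero; suc; _≤_; z≤n; s≤s)
import Data.Nat.Properties as ℕₚ
open import Data.Nat.ListAction using (sum)
open import Data.List.Base as List
  using (List; []; _∷_; [_]; map; concatMap; length; filter; zip; _++_; replicate; allFin; applyUpTo; upTo)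
open import Data.Fin as Fin using (Fin; toℕ)
import Data.Fin.Properties as Finₚ
open import Data.Vec.Base as Vec using (Vec; []; _∷_; lookup; updateAt)
import Data.Vec.Properties as Vecₚ
open import Data.Bool.ListAction using (all; and)
import Data.Bool.Properties as Boolₚ
import Data.List.Properties as Listₚ
open import Data.List.Relation.Unary.All using (All; []; _∷_; all?)
open import Data.List.Membership.DecPropositional ℕₚ._≟_ using (_∈_; _∈?_)
open import Data.List.Relation.Unary.Linked as Linked using (Linked; []; [-]; _∷_; linked?)
open import Data.Sum.Base using (_⊎_; inj₁; inj₂)
open import Data.Product.Base using (_×_; _,_; proj₁; proj₂; ∃-syntax; ∃₂)
open import Function.Base using (_∘_; case_of_)
open import Function.Bundles using (mk⇔)
open import Relation.Nullary using (Dec; does; yes; no; contradiction)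
open import Data.Empty using (⊥; ⊥-elim)
open import Relation.Nullary.Decidable using (⌊_⌋; isYes≗does; dec-true; does-⇔; _×-dec_; _→-dec_; ¬?)
open import Relation.Unary using (Decidable)
open import Relation.Binary.PropositionalEquality
  using (_≡_; _≢_; refl; sym; trans; cong; cong₂; module ≡-Reasoning)

-- Compositions as cut sequences

allCutSeqs : ℕ → List (List Bool)
allCutSeqs zero    = [ [] ]
allCutSeqs (suc m) = concatMap (λ b → (true ∷ b) ∷ (false ∷ b) ∷ []) (allCutSeqs m)

leadingFalses : List Bool → ℕ
leadingFalses (false ∷ b) = suc (leadingFalses b)
leadingFalses _           = 0

-- A cut sequence b of length m encodes the composition of m + 1 that has
-- i + 1 as a partial sum exactly when b has true at position i.
mutual
  composition : List Bool → List ℕ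
  composition b = suc (leadingFalses b) ∷ laterParts b

  laterParts : List Bool → List ℕ
  laterParts []          = []
  laterParts (true ∷ b)  = composition b
  laterParts (false ∷ b) = laterParts b

cutCount : List Bool → ℕ
cutCount b = length (laterParts b)

cutSet : List Bool → List ℕ
cutSet []          = []
cutSet (true ∷ b)  = 0 ∷ map suc (cutSet b)
cutSet (false ∷ b) = map suc (cutSet b)

compositions-allCutSeqs : ∀ m → compositions (suc m) ≡ map composition (allCutSeqs m)
compositions-allCutSeqs zero    = refl
compositions-allCutSeqs (suc m) = begin
  concatMap split (compositions (suc m))               ≡⟨ cong (concatMap split) (compositions-allCutSeqs m) ⟩
  concatMap split (map composition (allCutSeqs m))     ≡⟨ Listₚ.concatMap-map split composition (allCutSeqs m) ⟩
  concatMap (map composition ∘ extend) (allCutSeqs m)  ≡⟨ Listₚ.map-concatMap composition extend (allCutSeqs m) ⟨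
  map composition (concatMap extend (allCutSeqs m))    ∎
  where
  open ≡-Reasoning
  split : List ℕ → List (List ℕ)
  split α = (1 ∷ α) ∷ incHead α ∷ []
  extend : List Bool → List (List Bool)
  extend b = (true ∷ b) ∷ (false ∷ b) ∷ []

sub-incHead : ∀ α → sub (incHead α) ≡ map suc (sub α)
sub-incHead []          = refl
sub-incHead (a ∷ [])    = refl
sub-incHead (a ∷ b ∷ α) = cong (suc a ∷_) (Listₚ.map-∘ (sub (b ∷ α)))

sub-composition : ∀ b → sub (composition b) ≡ map suc (cutSet b)
sub-composition []          = refl
sub-composition (true ∷ b)  = cong (1 ∷_) (cong (map suc) (sub-composition b))
sub-composition (false ∷ b) = trans (sub-incHead (composition b)) (cong (map suc) (sub-composition b))

composition-injective : ∀ a b → composition a ≡ composition b → a ≡ b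
composition-injective []          []          _  = refl
composition-injective []          (true ∷ b)  ()
composition-injective []          (false ∷ b) ()
composition-injective (true ∷ a)  []          ()
composition-injective (false ∷ a) []          ()
composition-injective (true ∷ a)  (false ∷ b) ()
composition-injective (false ∷ a) (true ∷ b)  ()
composition-injective (true ∷ a)  (true ∷ b)  eq =
  cong (true ∷_) (composition-injective a b (Listₚ.∷-injectiveʳ eq))
composition-injective (false ∷ a) (false ∷ b) eq =
  cong (false ∷_) (composition-injective a b
    (cong₂ _∷_ (ℕₚ.suc-injective (Listₚ.∷-injectiveˡ eq)) (Listₚ.∷-injectiveʳ eq)))

positive-sum≡0 : ∀ {α} → All (1 ≤_) α → sum α ≡ 0 → α ≡ []
positive-sum≡0 []      _  = refl
positive-sum≡0 (s≤s _ ∷ _) ()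

composition-surjective : ∀ m {α} → All (1 ≤_) α → sum α ≡ suc m →
                         ∃[ a ] length a ≡ m × composition a ≡ α
composition-surjective m       {[]}              _              ()
composition-surjective zero    {suc zero ∷ α}    (_ ∷ pos) eq
  rewrite positive-sum≡0 pos (ℕₚ.suc-injective eq) = [] , refl , refl
composition-surjective (suc m) {suc zero ∷ α}    (_ ∷ pos) eq
  with a , refl , refl ← composition-surjective m pos (ℕₚ.suc-injective eq) = true ∷ a , refl , refl
composition-surjective zero    {suc (suc _) ∷ _} _              ()
composition-surjective (suc m) {suc (suc x) ∷ α} (_ ∷ pos) eq
  with a , refl , e ← composition-surjective m (s≤s z≤n ∷ pos) (ℕₚ.suc-injective eq) =
  false ∷ a , refl , cong incHead e

_≟ˡ_ : (α β : List ℕ) → Dec (α ≡ β)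
_≟ˡ_ = Listₚ.≡-dec ℕₚ._≟_

_≟ᶜ_ : (a b : List Bool) → Dec (a ≡ b)
_≟ᶜ_ = Listₚ.≡-dec Boolₚ._≟_

_⊑_ : List Bool → List Bool → Bool
(x ∷ a) ⊑ (y ∷ b) = (not x ∨ y) ∧ (a ⊑ b)
_       ⊑ _       = true

_∈ᵇ_ : ℕ → List ℕ → Bool
x ∈ᵇ xs = does (x ∈? xs)

suc∈ᵇmap-suc : ∀ x xs → suc x ∈ᵇ map suc xs ≡ x ∈ᵇ xs
suc∈ᵇmap-suc x []       = refl
suc∈ᵇmap-suc x (y ∷ xs) = cong (does (x ℕₚ.≟ y) ∨_) (suc∈ᵇmap-suc x xs)

0∈ᵇmap-suc : ∀ xs → 0 ∈ᵇ map suc xs ≡ false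
0∈ᵇmap-suc []       = refl
0∈ᵇmap-suc (y ∷ xs) = 0∈ᵇmap-suc xs

0∈ᵇcutSet : ∀ x b → 0 ∈ᵇ cutSet (x ∷ b) ≡ x
0∈ᵇcutSet true  b = refl
0∈ᵇcutSet false b = 0∈ᵇmap-suc (cutSet b)

suc∈ᵇcutSet : ∀ i x b → suc i ∈ᵇ cutSet (x ∷ b) ≡ i ∈ᵇ cutSet b
suc∈ᵇcutSet i true  b = suc∈ᵇmap-suc i (cutSet b)
suc∈ᵇcutSet i false b = suc∈ᵇmap-suc i (cutSet b)

does-all? : ∀ {A : Set} {P : A → Set} (P? : Decidable P) xs →
            does (all? P? xs) ≡ all (does ∘ P?) xs
does-all? P? []       = refl
does-all? P? (x ∷ xs) = cong (does (P? x) ∧_) (does-all? P? xs)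

all-∈ᵇ-map-suc : ∀ B B′ → (∀ i → suc i ∈ᵇ B ≡ i ∈ᵇ B′) →
                 ∀ A → all (_∈ᵇ B) (map suc A) ≡ all (_∈ᵇ B′) A
all-∈ᵇ-map-suc B B′ shift A =
  cong and (trans (sym (Listₚ.map-∘ A)) (Listₚ.map-cong shift A))

all∈ᵇcutSet-map-suc : ∀ y b A → all (_∈ᵇ cutSet (y ∷ b)) (map suc A) ≡ all (_∈ᵇ cutSet b) A
all∈ᵇcutSet-map-suc y b = all-∈ᵇ-map-suc (cutSet (y ∷ b)) (cutSet b) (λ i → suc∈ᵇcutSet i y b)

all∈ᵇcutSet : ∀ a b → length a ≡ length b → all (_∈ᵇ cutSet b) (cutSet a) ≡ a ⊑ b
all∈ᵇcutSet []          []      _  = refl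
all∈ᵇcutSet (true ∷ a)  (y ∷ b) eq =
  cong₂ _∧_ (0∈ᵇcutSet y b) (trans (all∈ᵇcutSet-map-suc y b (cutSet a)) (all∈ᵇcutSet a b (ℕₚ.suc-injective eq)))
all∈ᵇcutSet (false ∷ a) (y ∷ b) eq =
  trans (all∈ᵇcutSet-map-suc y b (cutSet a)) (all∈ᵇcutSet a b (ℕₚ.suc-injective eq))

⪰-composition : ∀ a b → length a ≡ length b → ⌊ composition b ⪰? composition a ⌋ ≡ a ⊑ b
⪰-composition a b eq = begin
  ⌊ composition b ⪰? composition a ⌋
    ≡⟨ isYes≗does (composition b ⪰? composition a) ⟩
  does (composition b ⪰? composition a)
    ≡⟨ does-all? (_∈? sub (composition b)) (sub (composition a)) ⟩
  all (_∈ᵇ sub (composition b)) (sub (composition a))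
    ≡⟨ cong₂ (λ B A → all (_∈ᵇ B) A) (sub-composition b) (sub-composition a) ⟩
  all (_∈ᵇ map suc (cutSet b)) (map suc (cutSet a))
    ≡⟨ all-∈ᵇ-map-suc (map suc (cutSet b)) (cutSet b) (λ i → suc∈ᵇmap-suc i (cutSet b)) (cutSet a) ⟩
  all (_∈ᵇ cutSet b) (cutSet a)
    ≡⟨ all∈ᵇcutSet a b eq ⟩
  a ⊑ b ∎
  where open ≡-Reasoning

extraCuts : List Bool → List Bool → ℕ
extraCuts (false ∷ a) (true ∷ b) = suc (extraCuts a b)
extraCuts (_ ∷ a)     (_ ∷ b)    = extraCuts a b
extraCuts _           _          = 0

cutCount-⊑ : ∀ a b → a ⊑ b ≡ true → length a ≡ length b → cutCount b ≡ cutCount a ℕ.+ extraCuts a b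
cutCount-⊑ []          []          _  _  = refl
cutCount-⊑ (true ∷ a)  (true ∷ b)  le eq = cong suc (cutCount-⊑ a b le (ℕₚ.suc-injective eq))
cutCount-⊑ (false ∷ a) (true ∷ b)  le eq =
  trans (cong suc (cutCount-⊑ a b le (ℕₚ.suc-injective eq))) (sym (ℕₚ.+-suc (cutCount a) (extraCuts a b)))
cutCount-⊑ (false ∷ a) (false ∷ b) le eq = cutCount-⊑ a b le (ℕₚ.suc-injective eq)
cutCount-⊑ (true ∷ a)  (false ∷ b) () _

cutCount-∸ : ∀ a b → a ⊑ b ≡ true → length a ≡ length b → cutCount b ℕ.∸ cutCount a ≡ extraCuts a b
cutCount-∸ a b le eq =
  trans (cong (ℕ._∸ cutCount a) (cutCount-⊑ a b le eq)) (ℕₚ.m+n∸m≡n (cutCount a) (extraCuts a b))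

-- k is the index of the current part of the coarser composition; every cut of b
-- that is not a cut of a contributes the index of the part it splits.
cutsWeight : ℕ → List Bool → List Bool → ℕ
cutsWeight k (true ∷ a)  (true ∷ b)  = cutsWeight (suc k) a b
cutsWeight k (false ∷ a) (true ∷ b)  = k ℕ.+ cutsWeight k a b
cutsWeight k (_ ∷ a)     (false ∷ b) = cutsWeight k a b
cutsWeight k _           _           = 0

sWeighted-newCut : ∀ k h as h′ bs →
  sWeighted k (blockSizes (suc (suc h) ∷ as) (1 ∷ suc h′ ∷ bs))
    ≡ k ℕ.+ sWeighted k (blockSizes (suc h ∷ as) (suc h′ ∷ bs))
sWeighted-newCut k h as h′ bs =
  trans (cong (ℕ._+ sWeighted (suc k) rest) (ℕₚ.*-suc k _)) (ℕₚ.+-assoc k _ _)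
  where
  rest : List ℕ
  rest = blockSizes as (proj₂ (takeParts (suc h) (suc h′ ∷ bs)))

s-composition : ∀ k a b → a ⊑ b ≡ true → length a ≡ length b →
                sWeighted k (blockSizes (composition a) (composition b)) ≡ cutsWeight k a b
s-composition k []          []          _  _  = cong (ℕ._+ 0) (ℕₚ.*-zeroʳ k)
s-composition k (true ∷ a)  (true ∷ b)  le eq =
  trans (cong (ℕ._+ sWeighted (suc k) (blockSizes (composition a) (composition b))) (ℕₚ.*-zeroʳ k))
        (s-composition (suc k) a b le (ℕₚ.suc-injective eq))
s-composition k (false ∷ a) (true ∷ b)  le eq =
  trans (sWeighted-newCut k (leadingFalses a) (laterParts a) (leadingFalses b) (laterParts b))
        (cong (k ℕ.+_) (s-composition k a b le (ℕₚ.suc-injective eq)))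
s-composition k (false ∷ a) (false ∷ b) le eq = s-composition k a b le (ℕₚ.suc-injective eq)
s-composition k (true ∷ a)  (false ∷ b) () _

-- whether the (i + 1)-th cut of b is also a cut of a
sharedCut : List Bool → List Bool → ℕ → Bool
sharedCut a b i = psum (composition b) (suc i) ∈ᵇ map suc (cutSet a)

1∈ᵇcutSet : ∀ x a → 1 ∈ᵇ map suc (cutSet (x ∷ a)) ≡ x
1∈ᵇcutSet x a = trans (suc∈ᵇmap-suc 0 (cutSet (x ∷ a))) (0∈ᵇcutSet x a)

ssuc∈ᵇcutSet : ∀ q x a → suc (suc q) ∈ᵇ map suc (cutSet (x ∷ a)) ≡ suc q ∈ᵇ map suc (cutSet a)
ssuc∈ᵇcutSet q x a =
  trans (suc∈ᵇmap-suc (suc q) (cutSet (x ∷ a))) (trans (suc∈ᵇcutSet q x a) (sym (suc∈ᵇmap-suc q (cutSet a))))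

sharedCut-cut : ∀ x a b i → sharedCut (x ∷ a) (true ∷ b) (suc i) ≡ sharedCut a b i
sharedCut-cut x a b i = ssuc∈ᵇcutSet (ℕ.pred (psum (composition b) (suc i))) x a

sharedCut-noCut : ∀ x a b i → sharedCut (x ∷ a) (false ∷ b) i ≡ sharedCut a b i
sharedCut-noCut x a b i = ssuc∈ᵇcutSet (ℕ.pred (psum (composition b) (suc i))) x a

-- Exponent vectors and sorted words

tally : ∀ {N} → List (Fin N) → Vec ℕ N
tally []      = Vec.replicate _ 0
tally (i ∷ w) = updateAt (tally w) i suc

weightedTally : ∀ {N} → List ℕ → List (Fin N) → Vec ℕ N
weightedTally (a ∷ α) (i ∷ is) = updateAt (weightedTally α is) i (ℕ._+ a)
weightedTally _       _        = Vec.replicate _ 0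

lookup-tally : ∀ {N} (w : List (Fin N)) i → lookup (tally w) i ≡ length (filter (Fin._≟ i) w)
lookup-tally []      i = Vecₚ.lookup-replicate i 0
lookup-tally (j ∷ w) i with j Fin.≟ i
... | yes refl = trans (Vecₚ.lookup∘updateAt j (tally w)) (cong suc (lookup-tally w j))
... | no j≢i   = trans (Vecₚ.lookup∘updateAt′ i j (j≢i ∘ sym) (tally w)) (lookup-tally w i)

content≡tally : ∀ {N} (w : List (Fin N)) → content w ≡ tally w
content≡tally w = trans (Vecₚ.tabulate-cong (sym ∘ lookup-tally w)) (Vecₚ.tabulate∘lookup (tally w))

lookup-weightedTally : ∀ {N} α (is : List (Fin N)) i →
  lookup (weightedTally α is) i ≡ sum (map proj₁ (filter (λ p → proj₂ p Fin.≟ i) (zip α is)))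
lookup-weightedTally []      is       i = Vecₚ.lookup-replicate i 0
lookup-weightedTally (a ∷ α) []       i = Vecₚ.lookup-replicate i 0
lookup-weightedTally (a ∷ α) (j ∷ is) i with j Fin.≟ i
... | yes refl = begin
  lookup (updateAt (weightedTally α is) j (ℕ._+ a)) j ≡⟨ Vecₚ.lookup∘updateAt j (weightedTally α is) ⟩
  lookup (weightedTally α is) j ℕ.+ a ≡⟨ ℕₚ.+-comm _ a ⟩
  a ℕ.+ lookup (weightedTally α is) j ≡⟨ cong (a ℕ.+_) (lookup-weightedTally α is j) ⟩
  a ℕ.+ sum (map proj₁ (filter (λ p → proj₂ p Fin.≟ j) (zip α is))) ∎
  where open ≡-Reasoning
... | no j≢i   = trans (Vecₚ.lookup∘updateAt′ i j (j≢i ∘ sym) (weightedTally α is)) (lookup-weightedTally α is i)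

expVec≡weightedTally : ∀ {N} α (is : List (Fin N)) → expVec α is ≡ weightedTally α is
expVec≡weightedTally α is =
  trans (Vecₚ.tabulate-cong (sym ∘ lookup-weightedTally α is)) (Vecₚ.tabulate∘lookup (weightedTally α is))

sum-replicate-0 : ∀ N → Vec.sum (Vec.replicate N 0) ≡ 0
sum-replicate-0 zero    = refl
sum-replicate-0 (suc N) = sum-replicate-0 N

sum-updateAt-suc : ∀ {N} (v : Vec ℕ N) i → Vec.sum (updateAt v i suc) ≡ suc (Vec.sum v)
sum-updateAt-suc (x ∷ v) Fin.zero    = refl
sum-updateAt-suc (x ∷ v) (Fin.suc i) = trans (cong (x ℕ.+_) (sum-updateAt-suc v i)) (ℕₚ.+-suc x (Vec.sum v))

sum-tally : ∀ {N} (w : List (Fin N)) → Vec.sum (tally w) ≡ length w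
sum-tally {N} []      = sum-replicate-0 N
sum-tally     (i ∷ w) = trans (sum-updateAt-suc (tally w) i) (cong suc (sum-tally w))

nonzeroParts : ∀ {N} → Vec ℕ N → List ℕ
nonzeroParts []          = []
nonzeroParts (zero  ∷ e) = nonzeroParts e
nonzeroParts (suc x ∷ e) = suc x ∷ nonzeroParts e

support : ∀ {N} → Vec ℕ N → List (Fin N)
support []          = []
support (zero  ∷ e) = map Fin.suc (support e)
support (suc x ∷ e) = Fin.zero ∷ map Fin.suc (support e)

sum-nonzeroParts : ∀ {N} (e : Vec ℕ N) → sum (nonzeroParts e) ≡ Vec.sum e
sum-nonzeroParts []          = refl
sum-nonzeroParts (zero  ∷ e) = sum-nonzeroParts e
sum-nonzeroParts (suc x ∷ e) = cong (suc x ℕ.+_) (sum-nonzeroParts e)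

length-support : ∀ {N} (e : Vec ℕ N) → length (support e) ≡ length (nonzeroParts e)
length-support []          = refl
length-support (zero  ∷ e) = trans (Listₚ.length-map Fin.suc (support e)) (length-support e)
length-support (suc x ∷ e) = cong suc (trans (Listₚ.length-map Fin.suc (support e)) (length-support e))

weightedTally-map-suc : ∀ {N} α (is : List (Fin N)) → weightedTally α (map Fin.suc is) ≡ 0 ∷ weightedTally α is
weightedTally-map-suc []      is       = refl
weightedTally-map-suc (a ∷ α) []       = refl
weightedTally-map-suc (a ∷ α) (i ∷ is) = cong (λ v → updateAt v (Fin.suc i) (ℕ._+ a)) (weightedTally-map-suc α is)

weightedTally-support : ∀ {N} (e : Vec ℕ N) → weightedTally (nonzeroParts e) (support e) ≡ e
weightedTally-support []          = refl
weightedTally-support (zero  ∷ e) =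
  trans (weightedTally-map-suc (nonzeroParts e) (support e)) (cong (0 ∷_) (weightedTally-support e))
weightedTally-support (suc x ∷ e) =
  cong (λ v → updateAt v Fin.zero (ℕ._+ suc x))
    (trans (weightedTally-map-suc (nonzeroParts e) (support e)) (cong (0 ∷_) (weightedTally-support e)))

Linked<-map-suc : ∀ {N} {is : List (Fin N)} → Linked Fin._<_ is → Linked Fin._<_ (map Fin.suc is)
Linked<-map-suc []          = []
Linked<-map-suc [-]         = [-]
Linked<-map-suc (i<j ∷ is<) = s≤s i<j ∷ Linked<-map-suc is<

Linked<-unmap-suc : ∀ {N} {is : List (Fin N)} → Linked Fin._<_ (map Fin.suc is) → Linked Fin._<_ is
Linked<-unmap-suc {is = []}         _               = []
Linked<-unmap-suc {is = _ ∷ []}     _               = [-]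
Linked<-unmap-suc {is = _ ∷ _ ∷ _} (s≤s i<j ∷ is<) = i<j ∷ Linked<-unmap-suc is<

Linked<-zero : ∀ {N} {is : List (Fin N)} → Linked Fin._<_ is → Linked Fin._<_ (Fin.zero ∷ map Fin.suc is)
Linked<-zero {is = []}    _   = [-]
Linked<-zero {is = _ ∷ _} is< = s≤s z≤n ∷ Linked<-map-suc is<

support-increasing : ∀ {N} (e : Vec ℕ N) → Linked Fin._<_ (support e)
support-increasing []          = []
support-increasing (zero  ∷ e) = Linked<-map-suc (support-increasing e)
support-increasing (suc x ∷ e) = Linked<-zero (support-increasing e)

increasing-tail-suc : ∀ {N} i (is : List (Fin (suc N))) → Linked Fin._<_ (i ∷ is) → ∃[ js ] is ≡ map Fin.suc js
increasing-tail-suc i []                 _             = [] , refl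
increasing-tail-suc i (Fin.suc j ∷ is)   (_ ∷ j∷is<)
  with js , refl ← increasing-tail-suc (Fin.suc j) is j∷is< = j ∷ js , refl

increasing-cases : ∀ {N} (is : List (Fin (suc N))) → Linked Fin._<_ is →
  (∃[ js ] is ≡ map Fin.suc js × Linked Fin._<_ js) ⊎
  (∃[ js ] is ≡ Fin.zero ∷ map Fin.suc js × Linked Fin._<_ js)
increasing-cases []                _   = inj₁ ([] , refl , [])
increasing-cases (Fin.zero ∷ is)   is<
  with js , refl ← increasing-tail-suc Fin.zero is is< = inj₂ (js , refl , Linked<-unmap-suc (Linked.tail is<))
increasing-cases (Fin.suc i ∷ is)  is<
  with js , refl ← increasing-tail-suc (Fin.suc i) is is< = inj₁ (i ∷ js , refl , Linked<-unmap-suc is<)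

weightedTally-leftInverse : ∀ {N} (is : List (Fin N)) α → Linked Fin._<_ is → All (1 ≤_) α →
  length is ≡ length α → support (weightedTally α is) ≡ is × nonzeroParts (weightedTally α is) ≡ α
weightedTally-leftInverse {zero}  []  []      _   _   _  = refl , refl
weightedTally-leftInverse {suc N} is  α       is< pos eq with increasing-cases is is<
... | inj₁ (js , refl , js<) rewrite weightedTally-map-suc α js =
  let supp , parts = weightedTally-leftInverse js α js< pos (trans (sym (Listₚ.length-map Fin.suc js)) eq)
  in cong (map Fin.suc) supp , parts
... | inj₂ (js , refl , js<) with α | pos | eq
...   | suc a ∷ α′ | _ ∷ pos′ | eq′ rewrite weightedTally-map-suc α′ js =
  let supp , parts = weightedTally-leftInverse js α′ js< pos′
                       (trans (sym (Listₚ.length-map Fin.suc js)) (ℕₚ.suc-injective eq′))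
  in cong (λ ks → Fin.zero ∷ map Fin.suc ks) supp , cong (suc a ∷_) parts

sortedWord : ∀ {N} → Vec ℕ N → List (Fin N)
sortedWord []      = []
sortedWord (x ∷ e) = replicate x Fin.zero ++ map Fin.suc (sortedWord e)

Linked≤-map-suc : ∀ {N} (w : List (Fin N)) → Linked Fin._≤_ w → Linked Fin._≤_ (map Fin.suc w)
Linked≤-map-suc []          _           = []
Linked≤-map-suc (_ ∷ [])    _           = [-]
Linked≤-map-suc (_ ∷ _ ∷ w) (i≤j ∷ w≤) = s≤s i≤j ∷ Linked≤-map-suc (_ ∷ w) w≤

zero∷-Linked≤ : ∀ {N} {w : List (Fin (suc N))} → Linked Fin._≤_ w → Linked Fin._≤_ (Fin.zero ∷ w)
zero∷-Linked≤ {w = []}    _  = [-]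
zero∷-Linked≤ {w = _ ∷ _} w≤ = z≤n ∷ w≤

zeros++-Linked≤ : ∀ {N} x (w : List (Fin N)) → Linked Fin._≤_ w →
                  Linked Fin._≤_ (replicate x Fin.zero ++ map Fin.suc w)
zeros++-Linked≤ zero    w w≤ = Linked≤-map-suc w w≤
zeros++-Linked≤ (suc x) w w≤ = zero∷-Linked≤ (zeros++-Linked≤ x w w≤)

sortedWord-sorted : ∀ {N} (e : Vec ℕ N) → Linked Fin._≤_ (sortedWord e)
sortedWord-sorted []      = []
sortedWord-sorted (x ∷ e) = zeros++-Linked≤ x (sortedWord e) (sortedWord-sorted e)

tally-map-suc : ∀ {N} (w : List (Fin N)) → tally (map Fin.suc w) ≡ 0 ∷ tally w
tally-map-suc []      = refl
tally-map-suc (i ∷ w) = cong (λ v → updateAt v (Fin.suc i) suc) (tally-map-suc w)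

tally-zeros++ : ∀ {N} x (w : List (Fin N)) → tally (replicate x Fin.zero ++ map Fin.suc w) ≡ x ∷ tally w
tally-zeros++ zero    w = tally-map-suc w
tally-zeros++ (suc x) w = cong (λ v → updateAt v Fin.zero suc) (tally-zeros++ x w)

tally-sortedWord : ∀ {N} (e : Vec ℕ N) → tally (sortedWord e) ≡ e
tally-sortedWord []      = refl
tally-sortedWord (x ∷ e) = trans (tally-zeros++ x (sortedWord e)) (cong (x ∷_) (tally-sortedWord e))

length-sortedWord : ∀ {N} (e : Vec ℕ N) → length (sortedWord e) ≡ Vec.sum e
length-sortedWord e = trans (sym (sum-tally (sortedWord e))) (cong Vec.sum (tally-sortedWord e))

sorted-tail-suc : ∀ {N} i (w : List (Fin (suc N))) → Linked Fin._≤_ (Fin.suc i ∷ w) →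
            ∃[ w′ ] w ≡ map Fin.suc w′ × Linked Fin._≤_ (i ∷ w′)
sorted-tail-suc i []               _                  = [] , refl , [-]
sorted-tail-suc i (Fin.suc j ∷ w)  (s≤s i≤j ∷ j∷w≤)
  with w′ , refl , j∷w′≤ ← sorted-tail-suc j w j∷w≤ = j ∷ w′ , refl , i≤j ∷ j∷w′≤

sorted-split : ∀ {N} (w : List (Fin (suc N))) → Linked Fin._≤_ w →
               ∃₂ λ x w′ → w ≡ replicate x Fin.zero ++ map Fin.suc w′ × Linked Fin._≤_ w′
sorted-split []               _  = 0 , [] , refl , []
sorted-split (Fin.zero ∷ w)   w≤
  with x , w′ , refl , w′≤ ← sorted-split w (Linked.tail w≤) = suc x , w′ , refl , w′≤
sorted-split (Fin.suc i ∷ w)  w≤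
  with w′ , refl , i∷w′≤ ← sorted-tail-suc i w w≤ = 0 , i ∷ w′ , refl , i∷w′≤

sorted-unique : ∀ {N} (w : List (Fin N)) → Linked Fin._≤_ w → w ≡ sortedWord (tally w)
sorted-unique {zero}  []  _  = refl
sorted-unique {suc N} w   w≤ with x , w′ , refl , w′≤ ← sorted-split w w≤ = begin
  replicate x Fin.zero ++ map Fin.suc w′
    ≡⟨ cong (λ v → replicate x Fin.zero ++ map Fin.suc v) (sorted-unique w′ w′≤) ⟩
  sortedWord (x ∷ tally w′)
    ≡⟨ cong sortedWord (tally-zeros++ x w′) ⟨
  sortedWord (tally (replicate x Fin.zero ++ map Fin.suc w′)) ∎
  where open ≡-Reasoning

ascents : ∀ {N} → List (Fin N) → List Bool
ascents (i ∷ j ∷ w) = does (i Fin.<? j) ∷ ascents (j ∷ w)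
ascents _           = []

length-ascents : ∀ {N} (w : List (Fin N)) → length (ascents w) ≡ ℕ.pred (length w)
length-ascents []          = refl
length-ascents (_ ∷ [])    = refl
length-ascents (_ ∷ j ∷ w) = cong suc (length-ascents (j ∷ w))

ascents-map-suc : ∀ {N} (w : List (Fin N)) → ascents (map Fin.suc w) ≡ ascents w
ascents-map-suc []          = refl
ascents-map-suc (_ ∷ [])    = refl
ascents-map-suc (i ∷ j ∷ w) = cong (does (i Fin.<? j) ∷_) (ascents-map-suc (j ∷ w))

ascents-zeros++[] : ∀ {N} x →
  ascents {suc N} (Fin.zero ∷ replicate x Fin.zero ++ map Fin.suc []) ≡ replicate x false ++ []
ascents-zeros++[] zero    = refl
ascents-zeros++[] (suc x) = cong (false ∷_) (ascents-zeros++[] x)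

ascents-zeros++ : ∀ {N} x j (w : List (Fin N)) →
  ascents (Fin.zero ∷ replicate x Fin.zero ++ map Fin.suc (j ∷ w)) ≡ replicate x false ++ true ∷ ascents (j ∷ w)
ascents-zeros++ zero    j w = cong (true ∷_) (ascents-map-suc (j ∷ w))
ascents-zeros++ (suc x) j w = cong (false ∷_) (ascents-zeros++ x j w)

composition-falses++ : ∀ x r → leadingFalses r ≡ 0 → composition (replicate x false ++ r) ≡ suc x ∷ laterParts r
composition-falses++ zero    r eq = cong (λ h → suc h ∷ laterParts r) eq
composition-falses++ (suc x) r eq = cong incHead (composition-falses++ x r eq)

nonzeroParts-sum≡0 : ∀ {N} (e : Vec ℕ N) → Vec.sum e ≡ 0 → nonzeroParts e ≡ []
nonzeroParts-sum≡0 []          _  = refl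
nonzeroParts-sum≡0 (zero  ∷ e) eq = nonzeroParts-sum≡0 e eq

nonzeroParts-sortedWord : ∀ {N} (e : Vec ℕ N) → sortedWord e ≢ [] →
                          nonzeroParts e ≡ composition (ascents (sortedWord e))
nonzeroParts-sortedWord []          ne = contradiction refl ne
nonzeroParts-sortedWord (zero  ∷ e) ne =
  trans (nonzeroParts-sortedWord e (ne ∘ cong (map Fin.suc)))
        (cong composition (sym (ascents-map-suc (sortedWord e))))
nonzeroParts-sortedWord (suc x ∷ e) _ with sortedWord e in eq
... | [] = begin
  suc x ∷ nonzeroParts e
    ≡⟨ cong (suc x ∷_) (nonzeroParts-sum≡0 e (trans (sym (length-sortedWord e)) (cong length eq))) ⟩
  suc x ∷ []
    ≡⟨ composition-falses++ x [] refl ⟨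
  composition (replicate x false ++ [])
    ≡⟨ cong composition (ascents-zeros++[] x) ⟨
  composition (ascents (Fin.zero ∷ replicate x Fin.zero ++ map Fin.suc [])) ∎
  where open ≡-Reasoning
... | j ∷ w = begin
  suc x ∷ nonzeroParts e
    ≡⟨ cong (suc x ∷_) (nonzeroParts-sortedWord e λ e≡[] → case trans (sym eq) e≡[] of λ ()) ⟩
  suc x ∷ composition (ascents (sortedWord e))
    ≡⟨ cong (λ v → suc x ∷ composition (ascents v)) eq ⟩
  suc x ∷ composition (ascents (j ∷ w))
    ≡⟨ composition-falses++ x (true ∷ ascents (j ∷ w)) refl ⟨
  composition (replicate x false ++ true ∷ ascents (j ∷ w))
    ≡⟨ cong composition (ascents-zeros++ x j w) ⟨
  composition (ascents (Fin.zero ∷ replicate x Fin.zero ++ map Fin.suc (j ∷ w))) ∎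
  where open ≡-Reasoning

Admissible : ∀ {N} → List ℕ → ℕ × Fin N × Fin N → Set
Admissible L p = proj₁ (proj₂ p) Fin.≤ proj₂ (proj₂ p) × (proj₁ p ∈ L → proj₁ (proj₂ p) Fin.< proj₂ (proj₂ p))

admissible? : ∀ {N} L → Decidable (Admissible {N} L)
admissible? L p =
  (proj₁ (proj₂ p) Fin.≤? proj₂ (proj₂ p)) ×-dec ((proj₁ p ∈? L) →-dec (proj₁ (proj₂ p) Fin.<? proj₂ (proj₂ p)))

admissible⇒sorted : ∀ {N} L j (w : List (Fin N)) → All (Admissible L) (adjacent j w) → Linked Fin._≤_ w
admissible⇒sorted L j []          _                  = []
admissible⇒sorted L j (_ ∷ [])    _                  = [-]
admissible⇒sorted L j (_ ∷ _ ∷ w) ((i≤k , _) ∷ adm) = i≤k ∷ admissible⇒sorted L (suc j) (_ ∷ w) adm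

-- On a weakly increasing word admissibility only asks for strict ascents at the
-- positions in L; the last hypothesis says that d lists these positions, shifted by j.
does-admissible-sorted : ∀ {N} L j d (w : List (Fin N)) → Linked Fin._≤_ w →
  length d ≡ length (ascents w) → (∀ i → (j ℕ.+ i) ∈ᵇ L ≡ i ∈ᵇ cutSet d) →
  does (all? (admissible? L) (adjacent j w)) ≡ d ⊑ ascents w
does-admissible-sorted L j []      []          _           _  _    = refl
does-admissible-sorted L j []      (_ ∷ [])    _           _  _    = refl
does-admissible-sorted L j (x ∷ d) (u ∷ v ∷ w) (u≤v ∷ w≤) eq cuts = cong₂ _∧_ head tail
  where
  head : does (u Fin.≤? v) ∧ (not (j ∈ᵇ L) ∨ does (u Fin.<? v)) ≡ not x ∨ does (u Fin.<? v)
  head = cong₂ (λ p q → p ∧ (not q ∨ does (u Fin.<? v)))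
           (dec-true (u Fin.≤? v) u≤v)
           (trans (cong (_∈ᵇ L) (sym (ℕₚ.+-identityʳ j))) (trans (cuts 0) (0∈ᵇcutSet x d)))
  tail : does (all? (admissible? L) (adjacent (suc j) (v ∷ w))) ≡ d ⊑ ascents (v ∷ w)
  tail = does-admissible-sorted L (suc j) d (v ∷ w) w≤ (ℕₚ.suc-injective eq)
           (λ i → trans (cong (_∈ᵇ L) (sym (ℕₚ.+-suc j i))) (trans (cuts (suc i)) (suc∈ᵇcutSet i x d)))

module Evaluation {c ℓ′ : Level} (R : CommutativeRing c ℓ′) where
  open CommutativeRing R renaming (refl to ≈-refl; sym to ≈-sym; trans to ≈-trans)
  open Poly R
  open import Relation.Binary.Reasoning.Setoid setoid
  open import Algebra.Properties.Monoid.Sum +-monoid using (sum-cong-≋; sum-replicate-zero) renaming (sum to ∑)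
  open import Algebra.Properties.CommutativeMonoid.Sum +-commutativeMonoid using (sum-remove)
  open import Algebra.Properties.Monoid.Sum *-monoid using () renaming (sum to ∏; sum-cong-≋ to ∏-cong)
  open import Algebra.Properties.Ring ring using (-1*x≈-x)
  open import Algebra.Properties.CommutativeSemigroup *-commutativeSemigroup using (x∙yz≈y∙xz)

  ιᵇ : Bool → Carrier
  ιᵇ b = if b then 1# else 0#

  ι≡ιᵇ : ∀ {P : Set} (P? : Dec P) → ι P? ≡ ιᵇ (does P?)
  ι≡ιᵇ P? = cong ιᵇ (isYes≗does P?)

  1·1·1≈1 : 1# * (1# * 1#) ≈ 1#
  1·1·1≈1 = ≈-trans (*-identityˡ _) (*-identityˡ 1#)

  ιᵇ-guard : ∀ {b b′ x y} → b ≡ b′ → (b′ ≡ true → x ≈ y) → ιᵇ b * x ≈ ιᵇ b′ * y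
  ιᵇ-guard {b′ = false} refl _ = ≈-trans (zeroˡ _) (≈-sym (zeroˡ _))
  ιᵇ-guard {b′ = true}  refl h = *-congˡ (h refl)

  ΣR-cong : ∀ {A : Set} (xs : List A) {f g : A → Carrier} → (∀ x → f x ≈ g x) → ΣR xs f ≈ ΣR xs g
  ΣR-cong []       _  = ≈-refl
  ΣR-cong (x ∷ xs) eq = +-cong (eq x) (ΣR-cong xs eq)

  ΣR-zero : ∀ {A : Set} (xs : List A) {f : A → Carrier} → (∀ x → f x ≈ 0#) → ΣR xs f ≈ 0#
  ΣR-zero []       _  = ≈-refl
  ΣR-zero (x ∷ xs) eq = ≈-trans (+-cong (eq x) (ΣR-zero xs eq)) (+-identityˡ 0#)

  ΣR-map : ∀ {A B : Set} (g : A → B) xs (f : B → Carrier) → ΣR (map g xs) f ≡ ΣR xs (f ∘ g)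
  ΣR-map g []       f = refl
  ΣR-map g (x ∷ xs) f = cong (f (g x) +_) (ΣR-map g xs f)

  ΣR-++ : ∀ {A : Set} (xs ys : List A) f → ΣR (xs ++ ys) f ≈ ΣR xs f + ΣR ys f
  ΣR-++ []       ys f = ≈-sym (+-identityˡ _)
  ΣR-++ (x ∷ xs) ys f = ≈-trans (+-congˡ (ΣR-++ xs ys f)) (≈-sym (+-assoc _ _ _))

  ΣR-concatMap : ∀ {A B : Set} (h : A → List B) xs f → ΣR (concatMap h xs) f ≈ ΣR xs (λ x → ΣR (h x) f)
  ΣR-concatMap h []       f = ≈-refl
  ΣR-concatMap h (x ∷ xs) f = ≈-trans (ΣR-++ (h x) (concatMap h xs) f) (+-congˡ (ΣR-concatMap h xs f))

  ΣR-+ : ∀ {A : Set} (xs : List A) f g → ΣR xs (λ x → f x + g x) ≈ ΣR xs f + ΣR xs g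
  ΣR-+ []       f g = ≈-sym (+-identityˡ 0#)
  ΣR-+ (x ∷ xs) f g = ≈-trans (+-congˡ (ΣR-+ xs f g))
    (solve 4 (λ a b c d → (a ⊕ b) ⊕ (c ⊕ d) ⊜ (a ⊕ c) ⊕ (b ⊕ d)) ≈-refl (f x) (g x) (ΣR xs f) (ΣR xs g))
    where open import Algebra.Solver.CommutativeMonoid +-commutativeMonoid

  ΣR-*ˡ : ∀ {A : Set} (xs : List A) a f → ΣR xs (λ x → a * f x) ≈ a * ΣR xs f
  ΣR-*ˡ []       a f = ≈-sym (zeroʳ a)
  ΣR-*ˡ (x ∷ xs) a f = ≈-trans (+-congˡ (ΣR-*ˡ xs a f)) (≈-sym (distribˡ a _ _))

  ΣR-tabulate : ∀ {A : Set} {n} (g : Fin n → A) f → ΣR (List.tabulate g) f ≡ ∑ (f ∘ g)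
  ΣR-tabulate {n = zero}  g f = refl
  ΣR-tabulate {n = suc n} g f = cong (f (g Fin.zero) +_) (ΣR-tabulate (g ∘ Fin.suc) f)

  ∑-zero : ∀ {n} (f : Fin n → Carrier) → (∀ i → f i ≈ 0#) → ∑ f ≈ 0#
  ∑-zero {n} f eq = ≈-trans (sum-cong-≋ eq) (sum-replicate-zero n)

  ∑-single : ∀ {n} (f : Fin n → Carrier) i → (∀ j → j ≢ i → f j ≈ 0#) → ∑ f ≈ f i
  ∑-single {suc n} f i eq = begin
    ∑ f                            ≈⟨ sum-remove {i = i} f ⟩
    f i + ∑ (f ∘ Fin.punchIn i)   ≈⟨ +-congˡ (∑-zero _ (λ j → eq _ (Finₚ.punchInᵢ≢i i j))) ⟩
    f i + 0#                       ≈⟨ +-identityʳ _ ⟩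
    f i                            ∎

  ΣR-allWords-suc : ∀ {N} k (f : List (Fin N) → Carrier) →
    ΣR (allWords (suc k) N) f ≈ ΣR (allWords k N) (λ w → ∑ (λ i → f (i ∷ w)))
  ΣR-allWords-suc {N} k f = ≈-trans (ΣR-concatMap (λ w → map (_∷ w) (allFin N)) (allWords k N) f)
    (ΣR-cong (allWords k N) λ w →
      reflexive (trans (ΣR-map (_∷ w) (allFin N) f) (ΣR-tabulate {n = N} (λ i → i) (f ∘ (_∷ w)))))

  ΣR-allWords-zero : ∀ {N} k (f : List (Fin N) → Carrier) → (∀ v → length v ≡ k → f v ≈ 0#) →
                     ΣR (allWords k N) f ≈ 0#
  ΣR-allWords-zero zero    f vanish = ≈-trans (+-identityʳ (f [])) (vanish [] refl)
  ΣR-allWords-zero (suc k) f vanish = ≈-trans (ΣR-allWords-suc k f)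
    (ΣR-allWords-zero k _ λ v len → ∑-zero _ λ i → vanish (i ∷ v) (cong suc len))

  ΣR-allWords-point : ∀ {N} k (f : List (Fin N) → Carrier) w → length w ≡ k →
                      (∀ v → length v ≡ k → v ≢ w → f v ≈ 0#) → ΣR (allWords k N) f ≈ f w
  ΣR-allWords-point zero    f []      _  _      = +-identityʳ (f [])
  ΣR-allWords-point (suc k) f (i ∷ w) eq vanish = begin
    ΣR (allWords (suc k) _) f                    ≈⟨ ΣR-allWords-suc k f ⟩
    ΣR (allWords k _) (λ v → ∑ (λ j → f (j ∷ v))) ≈⟨ ΣR-allWords-point k _ w (ℕₚ.suc-injective eq) off-w ⟩
    ∑ (λ j → f (j ∷ w))
      ≈⟨ ∑-single _ i (λ j j≢i → vanish (j ∷ w) eq (j≢i ∘ Listₚ.∷-injectiveˡ)) ⟩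
    f (i ∷ w)                                    ∎
    where
    off-w : ∀ v → length v ≡ k → v ≢ w → ∑ (λ j → f (j ∷ v)) ≈ 0#
    off-w v len v≢w = ∑-zero _ λ j → vanish (j ∷ v) (cong suc len) (v≢w ∘ Listₚ.∷-injectiveʳ)

  monomialTerm : ∀ {N} → List ℕ → Vec ℕ N → List (Fin N) → Carrier
  monomialTerm α e is = ι (linked? Fin._<?_ is) * ι (Vecₚ.≡-dec ℕₚ._≟_ (expVec α is) e)

  monomialTerm-vanishes : ∀ {N} α (e : Vec ℕ N) is →
    (Linked Fin._<_ is → weightedTally α is ≡ e → ⊥) → monomialTerm α e is ≈ 0#
  monomialTerm-vanishes α e is ¬term
    with linked? Fin._<?_ is | Vecₚ.≡-dec ℕₚ._≟_ (expVec α is) e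
  ... | yes is< | yes eq = ⊥-elim (¬term is< (trans (sym (expVec≡weightedTally α is)) eq))
  ... | yes _   | no _   = zeroʳ 1#
  ... | no _    | _      = zeroˡ _

  monomialTerm-support : ∀ {N} (e : Vec ℕ N) → monomialTerm (nonzeroParts e) e (support e) ≈ 1#
  monomialTerm-support e
    with linked? Fin._<?_ (support e) | Vecₚ.≡-dec ℕₚ._≟_ (expVec (nonzeroParts e) (support e)) e
  ... | yes _ | yes _ = *-identityˡ 1#
  ... | no ¬< | _     = ⊥-elim (¬< (support-increasing e))
  ... | yes _ | no ≢e =
    ⊥-elim (≢e (trans (expVec≡weightedTally (nonzeroParts e) (support e)) (weightedTally-support e)))

  M-eval : ∀ {N} α (e : Vec ℕ N) → All (1 ≤_) α → M α e ≈ ι (nonzeroParts e ≟ˡ α)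
  M-eval α e pos with nonzeroParts e ≟ˡ α
  ... | yes refl = ≈-trans
    (ΣR-allWords-point _ _ (support e) (length-support e) λ v len v≢ →
       monomialTerm-vanishes α e v λ v< eq →
         v≢ (trans (sym (proj₁ (weightedTally-leftInverse v α v< pos len))) (cong support eq)))
    (monomialTerm-support e)
  ... | no ≢α   = ΣR-allWords-zero _ _ λ v len → monomialTerm-vanishes α e v λ v< eq →
                     ≢α (trans (cong nonzeroParts (sym eq)) (proj₂ (weightedTally-leftInverse v α v< pos len)))

  fundamentalTerm : ∀ {N} → List ℕ → Vec ℕ N → List (Fin N) → Carrier
  fundamentalTerm β e w = ι (all? (admissible? (sub β)) (adjacent 1 w)) * ι (Vecₚ.≡-dec ℕₚ._≟_ (content w) e)

  F-vanishes : ∀ {N} n β (e : Vec ℕ N) → Vec.sum e ≢ n → F n β e ≈ 0#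
  F-vanishes n β e ≢n = ΣR-allWords-zero n (fundamentalTerm β e) vanish
    where
    vanish : ∀ v → length v ≡ n → fundamentalTerm β e v ≈ 0#
    vanish v len with Vecₚ.≡-dec ℕₚ._≟_ (content v) e
    ... | yes refl = ⊥-elim (≢n (trans (cong Vec.sum (content≡tally v)) (trans (sum-tally v) len)))
    ... | no _     = zeroʳ _

  F-eval : ∀ {N} n β (e : Vec ℕ N) → length (sortedWord e) ≡ n →
           F n β e ≈ ι (all? (admissible? (sub β)) (adjacent 1 (sortedWord e)))
  F-eval n β e len = ≈-trans (ΣR-allWords-point n (fundamentalTerm β e) (sortedWord e) len vanish) at-sortedWord
    where
    vanish : ∀ v → length v ≡ n → v ≢ sortedWord e → fundamentalTerm β e v ≈ 0#
    vanish v _ v≢ with all? (admissible? (sub β)) (adjacent 1 v) | Vecₚ.≡-dec ℕₚ._≟_ (content v) e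
    ... | yes adm | yes refl = ⊥-elim (v≢ (trans (sorted-unique v (admissible⇒sorted (sub β) 1 v adm))
                                               (cong sortedWord (sym (content≡tally v)))))
    ... | yes _   | no _     = zeroʳ 1#
    ... | no _    | _        = zeroˡ _
    at-sortedWord : fundamentalTerm β e (sortedWord e) ≈ ι (all? (admissible? (sub β)) (adjacent 1 (sortedWord e)))
    at-sortedWord with Vecₚ.≡-dec ℕₚ._≟_ (content (sortedWord e)) e
    ... | yes _  = *-identityʳ _
    ... | no ≢e  = ⊥-elim (≢e (trans (content≡tally (sortedWord e)) (tally-sortedWord e)))

  G-vanishes : ∀ {N} t n β (e : Vec ℕ N) → Vec.sum e ≢ n → G t n β e ≈ 0#
  G-vanishes t n β e ≢n = ΣR-zero (compositions n) λ δ →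
    ≈-trans (*-congˡ (≈-trans (*-congˡ (≈-trans (*-congˡ (F-vanishes n δ e ≢n)) (zeroʳ _))) (zeroʳ _))) (zeroʳ _)

  ΣR-allCutSeqs-suc : ∀ m (f : List Bool → Carrier) →
    ΣR (allCutSeqs (suc m)) f ≈ ΣR (allCutSeqs m) (λ b → f (true ∷ b) + f (false ∷ b))
  ΣR-allCutSeqs-suc m f =
    ≈-trans (ΣR-concatMap _ (allCutSeqs m) f) (ΣR-cong (allCutSeqs m) λ b → +-congˡ (+-identityʳ _))

  ΣR-allCutSeqs-cong : ∀ m {f g : List Bool → Carrier} → (∀ b → length b ≡ m → f b ≈ g b) →
                       ΣR (allCutSeqs m) f ≈ ΣR (allCutSeqs m) g
  ΣR-allCutSeqs-cong zero    eq = +-congʳ (eq [] refl)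
  ΣR-allCutSeqs-cong (suc m) {f} {g} eq = begin
    ΣR (allCutSeqs (suc m)) f                               ≈⟨ ΣR-allCutSeqs-suc m f ⟩
    ΣR (allCutSeqs m) (λ b → f (true ∷ b) + f (false ∷ b))
      ≈⟨ ΣR-allCutSeqs-cong m (λ b len → +-cong (eq (true ∷ b) (cong suc len)) (eq (false ∷ b) (cong suc len))) ⟩
    ΣR (allCutSeqs m) (λ b → g (true ∷ b) + g (false ∷ b))  ≈⟨ ΣR-allCutSeqs-suc m g ⟨
    ΣR (allCutSeqs (suc m)) g                               ∎

  ΣR-compositions : ∀ m (f : List ℕ → Carrier) → ΣR (compositions (suc m)) f ≡ ΣR (allCutSeqs m) (f ∘ composition)
  ΣR-compositions m f =
    trans (cong (λ cs → ΣR cs f) (compositions-allCutSeqs m)) (ΣR-map composition (allCutSeqs m) f)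

  F-composition : ∀ {N} m d (e : Vec ℕ N) → length d ≡ m → Vec.sum e ≡ suc m →
                  F (suc m) (composition d) e ≈ ιᵇ (d ⊑ ascents (sortedWord e))
  F-composition m d e len sum≡ = ≈-trans (F-eval (suc m) (composition d) e len-word) (reflexive (trans (ι≡ιᵇ _)
    (cong ιᵇ (does-admissible-sorted (sub (composition d)) 1 d (sortedWord e) (sortedWord-sorted e)
                                     len-ascents cuts))))
    where
    len-word : length (sortedWord e) ≡ suc m
    len-word = trans (length-sortedWord e) sum≡
    len-ascents : length d ≡ length (ascents (sortedWord e))
    len-ascents = trans len (sym (trans (length-ascents (sortedWord e)) (cong ℕ.pred len-word)))
    cuts : ∀ i → (1 ℕ.+ i) ∈ᵇ sub (composition d) ≡ i ∈ᵇ cutSet d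
    cuts i = trans (cong (suc i ∈ᵇ_) (sub-composition d)) (suc∈ᵇmap-suc i (cutSet d))

  M-composition : ∀ {N} m a (e : Vec ℕ N) → All (1 ≤_) (composition a) → Vec.sum e ≡ suc m →
                  M (composition a) e ≈ ιᵇ (does (a ≟ᶜ ascents (sortedWord e)))
  M-composition m a e pos sum≡ = ≈-trans (M-eval (composition a) e pos)
    (reflexive (trans (ι≡ιᵇ _) (cong ιᵇ (does-⇔ (mk⇔ to from) (nonzeroParts e ≟ˡ composition a) (a ≟ᶜ g)))))
    where
    g : List Bool
    g = ascents (sortedWord e)
    nonzero : nonzeroParts e ≡ composition g
    nonzero = nonzeroParts-sortedWord e λ sw≡[] →
      case trans (sym (cong length sw≡[])) (trans (length-sortedWord e) sum≡) of λ ()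
    to : nonzeroParts e ≡ composition a → a ≡ g
    to eq = composition-injective a g (trans (sym eq) nonzero)
    from : a ≡ g → nonzeroParts e ≡ composition a
    from eq = trans nonzero (cong composition (sym eq))

  F-degree0 : ∀ {N} (e : Vec ℕ N) → Vec.sum e ≡ 0 → F 0 [] e ≈ 1#
  F-degree0 e sum≡ = ≈-trans (F-eval 0 [] e len-word) (reflexive (trans (ι≡ιᵇ _)
    (cong ιᵇ (does-admissible-sorted [] 1 [] (sortedWord e) (sortedWord-sorted e) len-ascents λ _ → refl))))
    where
    len-word : length (sortedWord e) ≡ 0
    len-word = trans (length-sortedWord e) sum≡
    len-ascents : 0 ≡ length (ascents (sortedWord e))
    len-ascents = sym (trans (length-ascents (sortedWord e)) (cong ℕ.pred len-word))

  ΠR-map : ∀ {A B : Set} (g : A → B) xs (f : B → Carrier) → ΠR (map g xs) f ≡ ΠR xs (f ∘ g)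
  ΠR-map g []       f = refl
  ΠR-map g (x ∷ xs) f = cong (f (g x) *_) (ΠR-map g xs f)

  ΠR-applyUpTo : ∀ {A : Set} (g : ℕ → A) L f → ΠR (applyUpTo g L) f ≡ ∏ {L} (λ i → f (g (toℕ i)))
  ΠR-applyUpTo g zero    f = refl
  ΠR-applyUpTo g (suc L) f = cong (f (g 0) *_) (ΠR-applyUpTo (g ∘ suc) L f)

  ^-distribˡ-+-* : ∀ x m n → x ^ (m ℕ.+ n) ≈ x ^ m * x ^ n
  ^-distribˡ-+-* x zero    n = ≈-sym (*-identityˡ _)
  ^-distribˡ-+-* x (suc m) n = ≈-trans (*-congˡ (^-distribˡ-+-* x m n)) (≈-sym (*-assoc _ _ _))

  -- The inversion identity on cut sequences

  module _ (t : Carrier) where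

    cutProduct : ℕ → List Bool → List Bool → Carrier
    cutProduct k (true ∷ a)  (true ∷ b)  = cutProduct (suc k) a b
    cutProduct k (false ∷ a) (true ∷ b)  = (1# - t ^ suc k) * cutProduct (suc k) a b
    cutProduct k (_ ∷ a)     (false ∷ b) = cutProduct k a b
    cutProduct k _           _           = 1#

    -- In cut-sequence form: the coefficient of G_b in M_a, and the contribution of F_d
    -- to G_b at an exponent vector whose sorted word has ascent sequence g.
    -- The parameter k is the number of cuts of b to the left of the current position.
    mCoeff : ℕ → List Bool → List Bool → Carrier
    mCoeff k a b = ιᵇ (a ⊑ b) * ((- 1#) ^ extraCuts a b * cutProduct k a b)

    gTerm : ℕ → List Bool → List Bool → List Bool → Carrier
    gTerm k b d g = ιᵇ (b ⊑ d) * ((- 1#) ^ extraCuts b d * (t ^ cutsWeight (suc k) b d * ιᵇ (d ⊑ g)))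

    gValue : ℕ → ℕ → List Bool → List Bool → Carrier
    gValue m k b g = ΣR (allCutSeqs m) (λ d → gTerm k b d g)

    open import Algebra.Solver.CommutativeMonoid *-commutativeMonoid using (solve; _⊕_; _⊜_)

    mCoeff-newCut : ∀ k a b → mCoeff k (false ∷ a) (true ∷ b) ≈ (- 1# * (1# - t ^ suc k)) * mCoeff (suc k) a b
    mCoeff-newCut k a b = solve 5 (λ i m s u p → i ⊕ ((m ⊕ s) ⊕ (u ⊕ p)) ⊜ (m ⊕ u) ⊕ (i ⊕ (s ⊕ p))) ≈-refl
      (ιᵇ (a ⊑ b)) (- 1#) ((- 1#) ^ extraCuts a b) (1# - t ^ suc k) (cutProduct (suc k) a b)

    gTerm-newCut : ∀ k b d g → gTerm k (false ∷ b) (true ∷ d) (true ∷ g) ≈ (- 1# * t ^ suc k) * gTerm k b d g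
    gTerm-newCut k b d g = begin
      ιᵇ (b ⊑ d) * ((- 1# * σ) * (t ^ (suc k ℕ.+ w) * ιᵇ (d ⊑ g)))
        ≈⟨ *-congˡ (*-congˡ (*-congʳ (^-distribˡ-+-* t (suc k) w))) ⟩
      ιᵇ (b ⊑ d) * ((- 1# * σ) * ((t ^ suc k * t ^ w) * ιᵇ (d ⊑ g)))
        ≈⟨ solve 6 (λ i m s T U j → i ⊕ ((m ⊕ s) ⊕ ((T ⊕ U) ⊕ j)) ⊜ (m ⊕ T) ⊕ (i ⊕ (s ⊕ (U ⊕ j)))) ≈-refl
             (ιᵇ (b ⊑ d)) (- 1#) σ (t ^ suc k) (t ^ w) (ιᵇ (d ⊑ g)) ⟩
      (- 1# * t ^ suc k) * gTerm k b d g ∎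
      where
      σ : Carrier
      σ = (- 1#) ^ extraCuts b d
      w : ℕ
      w = cutsWeight (suc k) b d

    gValue-cut-cut : ∀ m k b g → gValue (suc m) k (true ∷ b) (true ∷ g) ≈ gValue m (suc k) b g
    gValue-cut-cut m k b g = ≈-trans (ΣR-allCutSeqs-suc m _)
      (ΣR-cong (allCutSeqs m) λ d → ≈-trans (+-congˡ (zeroˡ _)) (+-identityʳ _))

    gValue-cut-noCut : ∀ m k b g → gValue (suc m) k (true ∷ b) (false ∷ g) ≈ 0#
    gValue-cut-noCut m k b g = ≈-trans (ΣR-allCutSeqs-suc m _)
      (ΣR-zero (allCutSeqs m) λ d →
        ≈-trans (+-cong (≈-trans (*-congˡ (≈-trans (*-congˡ (zeroʳ _)) (zeroʳ _))) (zeroʳ _)) (zeroˡ _))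
                (+-identityʳ 0#))

    gValue-noCut-cut : ∀ m k b g → gValue (suc m) k (false ∷ b) (true ∷ g) ≈ (1# - t ^ suc k) * gValue m k b g
    gValue-noCut-cut m k b g = begin
      gValue (suc m) k (false ∷ b) (true ∷ g)
        ≈⟨ ΣR-allCutSeqs-suc m _ ⟩
      ΣR (allCutSeqs m) (λ d → gTerm k (false ∷ b) (true ∷ d) (true ∷ g) + gTerm k b d g)
        ≈⟨ ΣR-cong (allCutSeqs m) (λ d → +-cong (gTerm-newCut k b d g) (≈-sym (*-identityˡ _))) ⟩
      ΣR (allCutSeqs m) (λ d → (- 1# * t ^ suc k) * gTerm k b d g + 1# * gTerm k b d g)
        ≈⟨ ΣR-cong (allCutSeqs m) (λ d → ≈-sym (distribʳ _ _ _)) ⟩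
      ΣR (allCutSeqs m) (λ d → (- 1# * t ^ suc k + 1#) * gTerm k b d g)
        ≈⟨ ΣR-*ˡ (allCutSeqs m) _ _ ⟩
      (- 1# * t ^ suc k + 1#) * gValue m k b g
        ≈⟨ *-congʳ (≈-trans (+-comm _ _) (+-congˡ (-1*x≈-x _))) ⟩
      (1# - t ^ suc k) * gValue m k b g ∎

    gValue-noCut-noCut : ∀ m k b g → gValue (suc m) k (false ∷ b) (false ∷ g) ≈ gValue m k b g
    gValue-noCut-noCut m k b g = ≈-trans (ΣR-allCutSeqs-suc m _)
      (ΣR-cong (allCutSeqs m) λ d →
        ≈-trans (+-congʳ (≈-trans (*-congˡ (≈-trans (*-congˡ (zeroʳ _)) (zeroʳ _))) (zeroʳ _))) (+-identityˡ _))

    -- Splitting off the first letters x, y, z of a, b, g turns a summand of the inversion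
    -- identity into this multiple of the corresponding summand for the tails.
    headCoeff : ℕ → Bool → Bool → Bool → Carrier
    headCoeff k true  true  true  = 1#
    headCoeff k false true  true  = - 1# * (1# - t ^ suc k)
    headCoeff k false false true  = 1# - t ^ suc k
    headCoeff k false false false = 1#
    headCoeff k _     _     _     = 0#

    step-cut : ∀ m k x z a b g →
      mCoeff k (x ∷ a) (true ∷ b) * gValue (suc m) k (true ∷ b) (z ∷ g)
        ≈ headCoeff k x true z * (mCoeff (suc k) a b * gValue m (suc k) b g)
    step-cut m k true  true  a b g = ≈-trans (*-congˡ (gValue-cut-cut m k b g)) (≈-sym (*-identityˡ _))
    step-cut m k false true  a b g =
      ≈-trans (*-cong (mCoeff-newCut k a b) (gValue-cut-cut m k b g)) (*-assoc _ _ _)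
    step-cut m k true  false a b g =
      ≈-trans (*-congˡ (gValue-cut-noCut m k b g)) (≈-trans (zeroʳ _) (≈-sym (zeroˡ _)))
    step-cut m k false false a b g =
      ≈-trans (*-congˡ (gValue-cut-noCut m k b g)) (≈-trans (zeroʳ _) (≈-sym (zeroˡ _)))

    step-noCut : ∀ m k x z a b g →
      mCoeff k (x ∷ a) (false ∷ b) * gValue (suc m) k (false ∷ b) (z ∷ g)
        ≈ headCoeff k x false z * (mCoeff k a b * gValue m k b g)
    step-noCut m k true  z     a b g = ≈-trans (*-congʳ (zeroˡ _)) (≈-trans (zeroˡ _) (≈-sym (zeroˡ _)))
    step-noCut m k false true  a b g =
      ≈-trans (*-congˡ (gValue-noCut-cut m k b g)) (x∙yz≈y∙xz _ _ _)
    step-noCut m k false false a b g = ≈-trans (*-congˡ (gValue-noCut-noCut m k b g)) (≈-sym (*-identityˡ _))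

    headCoeff-sum : ∀ k x z a g →
      (headCoeff k x true z + headCoeff k x false z) * ιᵇ (does (a ≟ᶜ g)) ≈ ιᵇ (does ((x ∷ a) ≟ᶜ (z ∷ g)))
    headCoeff-sum k true  true  a g = ≈-trans (*-congʳ (+-identityʳ 1#)) (*-identityˡ _)
    headCoeff-sum k true  false a g = ≈-trans (*-congʳ (+-identityʳ 0#)) (zeroˡ _)
    headCoeff-sum k false true  a g = ≈-trans (*-congʳ cancel) (zeroˡ _)
      where
      cancel : - 1# * (1# - t ^ suc k) + (1# - t ^ suc k) ≈ 0#
      cancel = ≈-trans (+-congʳ (-1*x≈-x _)) (-‿inverseˡ _)
    headCoeff-sum k false false a g = ≈-trans (*-congʳ (+-identityˡ 1#)) (*-identityˡ _)

    inversion : ∀ m k a g → length a ≡ m → length g ≡ m →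
      ΣR (allCutSeqs m) (λ b → mCoeff k a b * gValue m k b g) ≈ ιᵇ (does (a ≟ᶜ g))
    inversion zero    k []      []      _  _  =
      ≈-trans (+-identityʳ _) (≈-trans (*-cong 1·1·1≈1 (≈-trans (+-identityʳ _) (≈-trans (*-identityˡ _) 1·1·1≈1)))
                                       (*-identityˡ 1#))
    inversion (suc m) k (x ∷ a) (z ∷ g) la lg = begin
      ΣR (allCutSeqs (suc m)) (λ b → mCoeff k (x ∷ a) b * gValue (suc m) k b (z ∷ g))
        ≈⟨ ΣR-allCutSeqs-suc m _ ⟩
      ΣR (allCutSeqs m) (λ b → mCoeff k (x ∷ a) (true ∷ b) * gValue (suc m) k (true ∷ b) (z ∷ g)
                             + mCoeff k (x ∷ a) (false ∷ b) * gValue (suc m) k (false ∷ b) (z ∷ g))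
        ≈⟨ ΣR-cong (allCutSeqs m) (λ b → +-cong (step-cut m k x z a b g) (step-noCut m k x z a b g)) ⟩
      ΣR (allCutSeqs m) (λ b → headCoeff k x true z * P (suc k) b + headCoeff k x false z * P k b)
        ≈⟨ ΣR-+ (allCutSeqs m) _ _ ⟩
      ΣR (allCutSeqs m) (λ b → headCoeff k x true z * P (suc k) b)
        + ΣR (allCutSeqs m) (λ b → headCoeff k x false z * P k b)
        ≈⟨ +-cong (ΣR-*ˡ (allCutSeqs m) _ (P (suc k))) (ΣR-*ˡ (allCutSeqs m) _ (P k)) ⟩
      headCoeff k x true z * ΣR (allCutSeqs m) (P (suc k)) + headCoeff k x false z * ΣR (allCutSeqs m) (P k)
        ≈⟨ +-cong (*-congˡ (inversion m (suc k) a g la′ lg′)) (*-congˡ (inversion m k a g la′ lg′)) ⟩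
      headCoeff k x true z * ιᵇ (does (a ≟ᶜ g)) + headCoeff k x false z * ιᵇ (does (a ≟ᶜ g))
        ≈⟨ distribʳ _ _ _ ⟨
      (headCoeff k x true z + headCoeff k x false z) * ιᵇ (does (a ≟ᶜ g))
        ≈⟨ headCoeff-sum k x z a g ⟩
      ιᵇ (does ((x ∷ a) ≟ᶜ (z ∷ g))) ∎
      where
      P : ℕ → List Bool → Carrier
      P k′ b = mCoeff k′ a b * gValue m k′ b g
      la′ : length a ≡ m
      la′ = ℕₚ.suc-injective la
      lg′ : length g ≡ m
      lg′ = ℕₚ.suc-injective lg

    cutFactor : Bool → ℕ → Carrier
    cutFactor z j = ιᵇ (not z) * (1# - t ^ j) + ιᵇ z

    cutFactor-true : ∀ j → cutFactor true j ≈ 1#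
    cutFactor-true j = ≈-trans (+-congʳ (zeroˡ _)) (+-identityˡ 1#)

    cutFactor-false : ∀ j → cutFactor false j ≈ 1# - t ^ j
    cutFactor-false j = ≈-trans (+-identityʳ _) (*-identityˡ _)

    cutFactors : ℕ → List Bool → List Bool → Carrier
    cutFactors k a b = ∏ {cutCount b} (λ i → cutFactor (sharedCut a b (toℕ i)) (k ℕ.+ suc (toℕ i)))

    cutFactors-cut : ∀ k x a b →
      ∏ {cutCount b} (λ i → cutFactor (sharedCut (x ∷ a) (true ∷ b) (suc (toℕ i))) (k ℕ.+ suc (suc (toℕ i))))
        ≈ cutFactors (suc k) a b
    cutFactors-cut k x a b =
      ∏-cong {cutCount b} λ i →
        reflexive (cong₂ cutFactor (sharedCut-cut x a b (toℕ i)) (ℕₚ.+-suc k (suc (toℕ i))))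

    cutFactors-noCut : ∀ k x a b → cutFactors k (x ∷ a) (false ∷ b) ≈ cutFactors k a b
    cutFactors-noCut k x a b =
      ∏-cong {cutCount b} λ i →
        reflexive (cong (λ z → cutFactor z (k ℕ.+ suc (toℕ i))) (sharedCut-noCut x a b (toℕ i)))

    cutFactors≈cutProduct : ∀ k a b → a ⊑ b ≡ true → length a ≡ length b → cutFactors k a b ≈ cutProduct k a b
    cutFactors≈cutProduct k []          []          _  _  = ≈-refl
    cutFactors≈cutProduct k (true ∷ a)  (true ∷ b)  le eq = ≈-trans
      (*-cong (cutFactor-true (k ℕ.+ 1))
              (≈-trans (cutFactors-cut k true a b) (cutFactors≈cutProduct (suc k) a b le (ℕₚ.suc-injective eq))))
      (*-identityˡ _)
    cutFactors≈cutProduct k (false ∷ a) (true ∷ b)  le eq = *-cong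
      (≈-trans (reflexive (cong₂ cutFactor (1∈ᵇcutSet false a) (ℕₚ.+-comm k 1))) (cutFactor-false (suc k)))
      (≈-trans (cutFactors-cut k false a b) (cutFactors≈cutProduct (suc k) a b le (ℕₚ.suc-injective eq)))
    cutFactors≈cutProduct k (false ∷ a) (false ∷ b) le eq =
      ≈-trans (cutFactors-noCut k false a b) (cutFactors≈cutProduct k a b le (ℕₚ.suc-injective eq))
    cutFactors≈cutProduct k (true ∷ a)  (false ∷ b) () _

    coeffMG-composition : ∀ a b → length a ≡ length b → coeffMG t (composition a) (composition b) ≈ mCoeff 0 a b
    coeffMG-composition a b eq = ιᵇ-guard (⪰-composition a b eq) λ le →
      *-cong (reflexive (cong ((- 1#) ^_) (cutCount-∸ a b le eq))) (factors le)
      where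
      factor : ℕ → Carrier
      factor j = ι (¬? (psum (composition b) j ∈? sub (composition a))) * (1# - t ^ j)
               + ι (psum (composition b) j ∈? sub (composition a))
      factor-cutFactor : ∀ j → factor j ≡ cutFactor (psum (composition b) j ∈ᵇ map suc (cutSet a)) j
      factor-cutFactor j = trans
        (cong₂ (λ p q → ιᵇ p * (1# - t ^ j) + ιᵇ q) (isYes≗does (¬? shared?)) (isYes≗does shared?))
        (cong (λ S → cutFactor (psum (composition b) j ∈ᵇ S) j) (sub-composition a))
        where
        shared? : Dec (psum (composition b) j ∈ sub (composition a))
        shared? = psum (composition b) j ∈? sub (composition a)
      factors : a ⊑ b ≡ true → ΠR (map suc (upTo (cutCount b))) factor ≈ cutProduct 0 a b
      factors le = begin
        ΠR (map suc (upTo (cutCount b))) factor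
          ≡⟨ trans (ΠR-map suc (upTo (cutCount b)) factor) (ΠR-applyUpTo (λ i → i) (cutCount b) _) ⟩
        ∏ {cutCount b} (λ i → factor (suc (toℕ i)))
          ≈⟨ ∏-cong {cutCount b} (λ i → reflexive (factor-cutFactor (suc (toℕ i)))) ⟩
        cutFactors 0 a b
          ≈⟨ cutFactors≈cutProduct 0 a b le eq ⟩
        cutProduct 0 a b ∎

    G-composition : ∀ {N} m b (e : Vec ℕ N) → length b ≡ m → Vec.sum e ≡ suc m →
                    G t (suc m) (composition b) e ≈ gValue m 0 b (ascents (sortedWord e))
    G-composition m b e len sum≡ = begin
      G t (suc m) (composition b) e                           ≡⟨ ΣR-compositions m summand ⟩
      ΣR (allCutSeqs m) (summand ∘ composition)                ≈⟨ ΣR-allCutSeqs-cong m term ⟩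
      gValue m 0 b (ascents (sortedWord e))                    ∎
      where
      summand : List ℕ → Carrier
      summand δ = ι (δ ⪰? composition b)
        * (((- 1#) ^ (ℓ δ ℕ.∸ ℓ (composition b))) * ((t ^ s (composition b) δ) * F (suc m) δ e))
      term : ∀ d → length d ≡ m → summand (composition d) ≈ gTerm 0 b d (ascents (sortedWord e))
      term d len-d = ιᵇ-guard (⪰-composition b d b≍d) λ le →
        *-cong (reflexive (cong ((- 1#) ^_) (cutCount-∸ b d le b≍d)))
               (*-cong (reflexive (cong (t ^_) (s-composition 1 b d le b≍d))) (F-composition m d e len-d sum≡))
        where
        b≍d : length b ≡ length d
        b≍d = trans len (sym len-d)

    expansion : ∀ {N} → ℕ → List ℕ → Vec ℕ N → Carrier
    expansion n α e = ΣR (compositions n) (λ β → coeffMG t α β * G t n β e)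

    expansion-offDegree : ∀ {N} n α (e : Vec ℕ N) → All (1 ≤_) α → sum α ≡ n → Vec.sum e ≢ n →
                          M α e ≈ expansion n α e
    expansion-offDegree n α e pos sum≡ ≢n with nonzeroParts e ≟ˡ α | M-eval α e pos
    ... | yes refl | _   = ⊥-elim (≢n (trans (sym (sum-nonzeroParts e)) sum≡))
    ... | no _     | M≈0 = ≈-trans M≈0 (≈-sym (ΣR-zero (compositions n) λ β →
                             ≈-trans (*-congˡ (G-vanishes t n β e ≢n)) (zeroʳ _)))

    expansion-degree0 : ∀ {N} (e : Vec ℕ N) → Vec.sum e ≡ 0 → M [] e ≈ expansion 0 [] e
    expansion-degree0 e sum≡ with nonzeroParts e ≟ˡ [] | M-eval [] e []
    ... | no ≢[] | _   = ⊥-elim (≢[] (nonzeroParts-sum≡0 e sum≡))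
    ... | yes _  | M≈1 =
      ≈-trans M≈1 (≈-sym (≈-trans (+-identityʳ _) (≈-trans (*-cong 1·1·1≈1 G≈1) (*-identityˡ 1#))))
      where
      G≈1 : G t 0 [] e ≈ 1#
      G≈1 = ≈-trans (+-identityʳ _)
              (≈-trans (*-identityˡ _) (≈-trans (*-identityˡ _) (≈-trans (*-identityˡ _) (F-degree0 e sum≡))))

    expansion-positive : ∀ {N} m a (e : Vec ℕ N) → All (1 ≤_) (composition a) → length a ≡ m → Vec.sum e ≡ suc m →
                         M (composition a) e ≈ expansion (suc m) (composition a) e
    expansion-positive m a e pos len sum≡ = begin
      M (composition a) e
        ≈⟨ M-composition m a e pos sum≡ ⟩
      ιᵇ (does (a ≟ᶜ g))
        ≈⟨ inversion m 0 a g len len-g ⟨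
      ΣR (allCutSeqs m) (λ b → mCoeff 0 a b * gValue m 0 b g)
        ≈⟨ ΣR-allCutSeqs-cong m (λ b len-b →
             *-cong (coeffMG-composition a b (trans len (sym len-b))) (G-composition m b e len-b sum≡)) ⟨
      ΣR (allCutSeqs m) (λ b → coeffMG t (composition a) (composition b) * G t (suc m) (composition b) e)
        ≡⟨ ΣR-compositions m (λ β → coeffMG t (composition a) β * G t (suc m) β e) ⟨
      expansion (suc m) (composition a) e ∎
      where
      g : List Bool
      g = ascents (sortedWord e)
      len-g : length g ≡ m
      len-g = trans (length-ascents (sortedWord e)) (cong ℕ.pred (trans (length-sortedWord e) sum≡))

theorem5p2 : {c ℓ′ : Level} (R : CommutativeRing c ℓ′) (t : CommutativeRing.Carrier R)
             (n N : ℕ) → n ≤ N → (α : List ℕ) → IsComposition n α →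
             (e : Vec ℕ N) →
             CommutativeRing._≈_ R
               (Poly.M R α e)
               (Poly.ΣR R (compositions n) (λ β →
                  CommutativeRing._*_ R (Poly.coeffMG R t α β) (Poly.G R t n β e)))
theorem5p2 R t n N _ α (pos , sum≡) e with Vec.sum e ℕₚ.≟ n
... | no ≢n = Evaluation.expansion-offDegree R t n α e pos sum≡ ≢n
theorem5p2 R t zero N _ α (pos , sum≡) e | yes e-deg
  with refl ← positive-sum≡0 pos sum≡ = Evaluation.expansion-degree0 R t e e-deg
theorem5p2 R t (suc m) N _ α (pos , sum≡) e | yes e-deg
  with a , len , refl ← composition-surjective m pos sum≡ = Evaluation.expansion-positive R t m a e pos len e-deg
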